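{- Let $\Gamma,\Gamma'\subseteq M_n(D)$ be tiled orders containing $\mathrm{diag}(\Delta,\dots,\Delta)$ with $\Gamma\sim\Gamma'$, and let $\xi=(\boldsymbol{\pi}^{\alpha_i}\delta_{\tau(i)j})$ be a monomial matrix ($\alpha_i\in\mathbb{Z}$, $\tau\in S_n$). Then $\xi\Gamma\xi^{ -1}\sim\xi\Gamma'\xi^{ -1}$; hence the group of monomial matrices acts on $\sim$-classes by $\xi[\Gamma]=[\xi\Gamma\xi^{ -1}]$. Moreover, if $\Gamma$ has structural invariants $m_{ij\ell}$ and types of distinguished vertices $t_i$, then $\xi\Gamma\xi^{ -1}$ has structural invariants $m_{\tau(i)\tau(j)\tau(\ell)}$ and types $t(\xi)+t_{\tau(i)}$ ($1\le i\le n$).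
   Context: Setting: $k$ non-archimedean local field of characteristic $0$; $D$ central division algebra over $k$ with maximal order $\Delta$, prime element $\boldsymbol{\pi}$, $\mathfrak{p}=\boldsymbol{\pi}\Delta$. A tiled order containing $\mathrm{diag}(\Delta,\dots,\Delta)$ is $\Gamma=(\mathfrak{p}^{\mu_{ij}})$ with $\mu_{ij}\in\mathbb{Z}$, $\mu_{ii}=0$, $\mu_{ij}+\mu_{j\ell}\ge\mu_{i\ell}$. Structural invariants: $m_{ij\ell}=\mu_{ij}+\mu_{j\ell}-\mu_{i\ell}$. Types of distinguished vertices: $t_j\equiv\sum_{i}\mu_{ij}\pmod n$. Type of a monomial matrix $(\boldsymbol{\pi}^{\alpha_i}\delta_{\tau(i)j})$: $t(\xi)\equiv\sum_i\alpha_i\pmod n$. Equivalence: $\Gamma\sim\Gamma'$ iff there is $\sigma\in S_n$ with $m'_{ij\ell}=m_{\sigma(i)\sigma(j)\sigma(\ell)}$ and $t'_i\equiv t_{\sigma(i)}\pmod n$ for all $i,j,\ell$; $[\Gamma]$ denotes the class. -}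

module Defs where

open import Data.Nat using (ℕ; zero; suc)
open import Data.Fin using (Fin; zero; suc)
open import Data.Fin.Permutation using (Permutation′; _⟨$⟩ʳ_; _∘ₚ_)
open import Data.Integer using (ℤ; +_; _+_; _-_; _*_; _≤_)
open import Data.Integer.Divisibility using (_∣_)
open import Data.Product using (Σ; _×_)
open import Relation.Binary.PropositionalEquality using (_≡_)

-- Exponent matrix of a tiled order Γ = (p^{μ i j}) ⊆ M_n(D) containing diag(Δ,…,Δ).
-- Such a tiled order is determined by (and identified with) its exponent matrix μ.
ExpMat : ℕ → Set
ExpMat n = Fin n → Fin n → ℤ

record IsTiled {n : ℕ} (μ : ExpMat n) : Set where
  field
    diag-zero : ∀ i → μ i i ≡ + 0
    triangle  : ∀ i j l → μ i l ≤ μ i j + μ j l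

sumFin : ∀ {n} → (Fin n → ℤ) → ℤ
sumFin {zero}  f = + 0
sumFin {suc n} f = f zero + sumFin (λ i → f (suc i))

_≡[mod_]_ : ℤ → ℕ → ℤ → Set
a ≡[mod n ] b = (+ n) ∣ (a - b)

m : ∀ {n} → ExpMat n → Fin n → Fin n → Fin n → ℤ
m μ i j l = (μ i j + μ j l) - μ i l

-- types of distinguished vertices t_j = Σ_i μ_ij (as integers; compared mod n)
t : ∀ {n} → ExpMat n → Fin n → ℤ
t μ j = sumFin (λ i → μ i j)

_∼_ : ∀ {n} → ExpMat n → ExpMat n → Set
_∼_ {n} μ μ′ = Σ (Permutation′ n) λ σ →
  (∀ i j l → m μ′ i j l ≡ m μ (σ ⟨$⟩ʳ i) (σ ⟨$⟩ʳ j) (σ ⟨$⟩ʳ l))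
  × (∀ i → t μ′ i ≡[mod n ] t μ (σ ⟨$⟩ʳ i))

-- Monomial matrix ξ = (π^{α i} δ_{τ(i) j}), given by α : Fin n → ℤ and τ ∈ S_n.
record Monomial (n : ℕ) : Set where
  constructor mono
  field
    α : Fin n → ℤ
    τ : Permutation′ n
open Monomial public

tMono : ∀ {n} → Monomial n → ℤ
tMono ξ = sumFin (α ξ)

-- Product of monomial matrices: (π^{α_i} δ_{τ(i) j})(π^{β_i} δ_{ρ(i) j})
--   = (π^{α_i + β_{τ(i)}} δ_{ρ(τ(i)) j}).
_·ₘ_ : ∀ {n} → Monomial n → Monomial n → Monomial n
mono a τ₁ ·ₘ mono b ρ = mono (λ i → a i + b (τ₁ ⟨$⟩ʳ i)) (τ₁ ∘ₚ ρ)

idₘ : ∀ {n} → Monomial n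
idₘ = mono (λ _ → + 0) Data.Fin.Permutation.id

-- Exponent matrix of ξ Γ ξ⁻¹: its (i,j) entry is
--   π^{α_i} p^{μ_{τ(i) τ(j)}} π^{-α_j} = p^{α_i + μ_{τ(i)τ(j)} - α_j}.
conj : ∀ {n} → Monomial n → ExpMat n → ExpMat n
conj ξ μ i j = (α ξ i + μ (τ ξ ⟨$⟩ʳ i) (τ ξ ⟨$⟩ʳ j)) - α ξ j

{-# OPTIONS --safe #-}
module Submission where

-- Conjugating by ξ reindexes the exponent matrix by τ and adds the coboundary
-- α i - α j.  The coboundary cancels in every m i j l and on the diagonal, so
-- tiledness and the structural invariants are just reindexed; in the column sum
-- t j it contributes Σ α - n α j ≡ t(ξ) (mod n).  An equivalence σ between μ
-- and μ′ is therefore carried to the equivalence τ⁻¹ σ τ between the conjugates.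

open import Defs
open import Level using (0ℓ)
open import Function using (_∘_)
open import Data.Nat using (ℕ; zero; suc)
import Data.Nat.Divisibility as ℕ
open import Data.Fin using (Fin; zero; suc)
open import Data.Fin.Permutation using (Permutation′; _⟨$⟩ʳ_; _∘ₚ_; flip; inverseʳ)
open import Data.Integer using (ℤ; +_; 0ℤ; -_; _+_; _-_; _*_; _≤_)
open import Data.Integer.Properties
  using (+-0-commutativeMonoid; +-identityˡ; +-identityʳ; +-inverseʳ; ∣i-j∣≡∣j-i∣; neg-distribʳ-*; suc-*;
         i≤j⇒0≤j-i; 0≤i-j⇒j≤i)
open import Data.Integer.Divisibility using (_∣_)
import Data.Integer.Divisibility.Signed as Signed
open import Data.Integer.Tactic.RingSolver using (solve-∀)
open import Data.Product using (_×_; _,_)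
open import Relation.Binary.Bundles using (Setoid)
import Relation.Binary.Reasoning.Setoid as ≈-Reasoning
open import Relation.Binary.PropositionalEquality
  using (_≡_; refl; sym; trans; cong; cong₂; subst; module ≡-Reasoning)
open import Algebra.Properties.CommutativeMonoid.Sum +-0-commutativeMonoid
  using (sum; sum-permute; ∑-distrib-+)

module _ {n : ℕ} where

  private
    toSigned : ∀ a b → a ≡[mod n ] b → + n Signed.∣ a - b
    toSigned _ _ = Signed.∣ᵤ⇒∣

    fromSigned : ∀ a b → + n Signed.∣ a - b → a ≡[mod n ] b
    fromSigned _ _ = Signed.∣⇒∣ᵤ

  ≡[mod]-refl : ∀ a → a ≡[mod n ] a
  ≡[mod]-refl a = subst (+ n ∣_) (sym (+-inverseʳ a)) (n ℕ.∣0)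

  ≡[mod]-sym : ∀ a b → a ≡[mod n ] b → b ≡[mod n ] a
  ≡[mod]-sym a b = subst (ℕ._∣_ n) (∣i-j∣≡∣j-i∣ a b)

  ≡[mod]-trans : ∀ a b c → a ≡[mod n ] b → b ≡[mod n ] c → a ≡[mod n ] c
  ≡[mod]-trans a b c p q =
    fromSigned a c (subst (+ n Signed.∣_) (telescope a b c)
                          (Signed.∣m∣n⇒∣m+n (toSigned a b p) (toSigned b c q)))
    where
    telescope : ∀ a b c → (a - b) + (b - c) ≡ a - c
    telescope = solve-∀

  ≡[mod]-+-congˡ : ∀ c a b → a ≡[mod n ] b → (c + a) ≡[mod n ] (c + b)
  ≡[mod]-+-congˡ c a b p =
    fromSigned (c + a) (c + b) (subst (+ n Signed.∣_) (cancel c a b) (toSigned a b p))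
    where
    cancel : ∀ c a b → a - b ≡ (c + a) - (c + b)
    cancel = solve-∀

  i-n*k≡i[mod] : ∀ i k → (i - + n * k) ≡[mod n ] i
  i-n*k≡i[mod] i k = fromSigned (i - + n * k) i (subst (+ n Signed.∣_) (cancel i (+ n * k))
                                                        (Signed.∣m⇒∣-m (Signed.∣m⇒∣m*n k Signed.∣-refl)))
    where
    cancel : ∀ i j → - j ≡ (i - j) - i
    cancel = solve-∀

≡[mod]-setoid : ℕ → Setoid 0ℓ 0ℓ
≡[mod]-setoid n = record
  { Carrier = ℤ
  ; _≈_ = _≡[mod n ]_
  ; isEquivalence = record
    { refl = λ {a} → ≡[mod]-refl a
    ; sym = λ {a} {b} → ≡[mod]-sym a b
    ; trans = λ {a} {b} {c} → ≡[mod]-trans a b c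
    }
  }

sumFin≡sum : ∀ {n} (f : Fin n → ℤ) → sumFin f ≡ sum f
sumFin≡sum {zero}  f = refl
sumFin≡sum {suc n} f = cong (λ s → f zero + s) (sumFin≡sum (f ∘ suc))

sumFin-permute : ∀ {n} (f : Fin n → ℤ) (π : Permutation′ n) → sumFin f ≡ sumFin (f ∘ (π ⟨$⟩ʳ_))
sumFin-permute f π = begin
  sumFin f                 ≡⟨ sumFin≡sum f ⟩
  sum f                    ≡⟨ sum-permute f π ⟩
  sum (f ∘ (π ⟨$⟩ʳ_))      ≡⟨ sym (sumFin≡sum (f ∘ (π ⟨$⟩ʳ_))) ⟩
  sumFin (f ∘ (π ⟨$⟩ʳ_))   ∎
  where open ≡-Reasoning

sumFin-distrib-+ : ∀ {n} (f g : Fin n → ℤ) → sumFin (λ i → f i + g i) ≡ sumFin f + sumFin g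
sumFin-distrib-+ f g = begin
  sumFin (λ i → f i + g i)  ≡⟨ sumFin≡sum (λ i → f i + g i) ⟩
  sum (λ i → f i + g i)     ≡⟨ ∑-distrib-+ f g ⟩
  sum f + sum g             ≡⟨ sym (cong₂ _+_ (sumFin≡sum f) (sumFin≡sum g)) ⟩
  sumFin f + sumFin g       ∎
  where open ≡-Reasoning

sumFin-const : ∀ n (c : ℤ) → sumFin {n} (λ _ → c) ≡ + n * c
sumFin-const zero    c = refl
sumFin-const (suc n) c = trans (cong (λ s → c + s) (sumFin-const n c)) (sym (suc-* (+ n) c))

conj-idₘ : ∀ {n} (μ : ExpMat n) i j → conj idₘ μ i j ≡ μ i j
conj-idₘ μ i j = trans (+-identityʳ (+ 0 + μ i j)) (+-identityˡ (μ i j))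

module _ {n : ℕ} (ξ : Monomial n) where

  private
    T : Fin n → Fin n
    T = τ ξ ⟨$⟩ʳ_

  conj-·ₘ : ∀ η (μ : ExpMat n) i j → conj (ξ ·ₘ η) μ i j ≡ conj ξ (conj η μ) i j
  conj-·ₘ η μ i j =
    regroup (α ξ i) (α ξ j) (α η (T i)) (α η (T j)) (μ (τ η ⟨$⟩ʳ T i) (τ η ⟨$⟩ʳ T j))
    where
    regroup : ∀ a a′ b b′ x → ((a + b) + x) - (a′ + b′) ≡ (a + ((b + x) - b′)) - a′
    regroup = solve-∀

  m-conj : ∀ (μ : ExpMat n) i j l → m (conj ξ μ) i j l ≡ m μ (T i) (T j) (T l)
  m-conj μ i j l = cancel (α ξ i) (α ξ j) (α ξ l) (μ (T i) (T j)) (μ (T j) (T l)) (μ (T i) (T l))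
    where
    cancel : ∀ a a′ a″ x y z → (((a + x) - a′) + ((a′ + y) - a″)) - ((a + z) - a″) ≡ (x + y) - z
    cancel = solve-∀

  conj-isTiled : ∀ {μ : ExpMat n} → IsTiled μ → IsTiled (conj ξ μ)
  conj-isTiled {μ} μ-tiled = record { diag-zero = diag-zero′ ; triangle = triangle′ }
    where
    open IsTiled μ-tiled
    diag-zero′ : ∀ i → conj ξ μ i i ≡ + 0
    diag-zero′ i = begin
      (α ξ i + μ (T i) (T i)) - α ξ i  ≡⟨ cong (λ x → (α ξ i + x) - α ξ i) (diag-zero (T i)) ⟩
      (α ξ i + + 0) - α ξ i            ≡⟨ cong (_- α ξ i) (+-identityʳ (α ξ i)) ⟩
      α ξ i - α ξ i                    ≡⟨ +-inverseʳ (α ξ i) ⟩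
      + 0                              ∎
      where open ≡-Reasoning
    triangle′ : ∀ i j l → conj ξ μ i l ≤ conj ξ μ i j + conj ξ μ j l
    triangle′ i j l =
      0≤i-j⇒j≤i (subst (0ℤ ≤_) (sym (m-conj μ i j l)) (i≤j⇒0≤j-i (triangle (T i) (T j) (T l))))

  t-conj : ∀ (μ : ExpMat n) j → t (conj ξ μ) j ≡ (tMono ξ + t μ (T j)) - + n * α ξ j
  t-conj μ j = begin
    sumFin (λ i → (α ξ i + μ (T i) (T j)) - α ξ j)
      ≡⟨ sumFin-distrib-+ (λ i → α ξ i + μ (T i) (T j)) (λ _ → - α ξ j) ⟩
    sumFin (λ i → α ξ i + μ (T i) (T j)) + sumFin {n} (λ _ → - α ξ j)
      ≡⟨ cong₂ _+_ (sumFin-distrib-+ (α ξ) (λ i → μ (T i) (T j))) (sumFin-const n (- α ξ j)) ⟩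
    (tMono ξ + sumFin (λ i → μ (T i) (T j))) + + n * - α ξ j
      ≡⟨ cong₂ (λ s c → (tMono ξ + s) + c)
               (sym (sumFin-permute (λ i → μ i (T j)) (τ ξ))) (sym (neg-distribʳ-* (+ n) (α ξ j))) ⟩
    (tMono ξ + t μ (T j)) - + n * α ξ j
      ∎
    where open ≡-Reasoning

  t-conj≡[mod] : ∀ (μ : ExpMat n) j → t (conj ξ μ) j ≡[mod n ] (tMono ξ + t μ (T j))
  t-conj≡[mod] μ j = subst (_≡[mod n ] (tMono ξ + t μ (T j))) (sym (t-conj μ j))
                            (i-n*k≡i[mod] (tMono ξ + t μ (T j)) (α ξ j))

  conj-resp-∼ : ∀ {μ μ′ : ExpMat n} → μ ∼ μ′ → conj ξ μ ∼ conj ξ μ′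
  conj-resp-∼ {μ} {μ′} (σ , m-eq , t-eq) = σ′ , m-eq′ , t-eq′
    where
    σ′ : Permutation′ n
    σ′ = τ ξ ∘ₚ σ ∘ₚ flip (τ ξ)

    T∘σ′ : ∀ i → T (σ′ ⟨$⟩ʳ i) ≡ σ ⟨$⟩ʳ T i
    T∘σ′ i = inverseʳ (τ ξ)

    m-eq′ : ∀ i j l → m (conj ξ μ′) i j l ≡ m (conj ξ μ) (σ′ ⟨$⟩ʳ i) (σ′ ⟨$⟩ʳ j) (σ′ ⟨$⟩ʳ l)
    m-eq′ i j l rewrite m-conj μ′ i j l | m-conj μ (σ′ ⟨$⟩ʳ i) (σ′ ⟨$⟩ʳ j) (σ′ ⟨$⟩ʳ l)
                      | T∘σ′ i | T∘σ′ j | T∘σ′ l = m-eq (T i) (T j) (T l)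

    t-eq′ : ∀ i → t (conj ξ μ′) i ≡[mod n ] t (conj ξ μ) (σ′ ⟨$⟩ʳ i)
    t-eq′ i = begin
      t (conj ξ μ′) i                ≈⟨ t-conj≡[mod] μ′ i ⟩
      tMono ξ + t μ′ (T i)           ≈⟨ ≡[mod]-+-congˡ (tMono ξ) (t μ′ (T i)) (t μ (σ ⟨$⟩ʳ T i)) (t-eq (T i)) ⟩
      tMono ξ + t μ (σ ⟨$⟩ʳ T i)     ≡⟨ cong (λ k → tMono ξ + t μ k) (sym (T∘σ′ i)) ⟩
      tMono ξ + t μ (T (σ′ ⟨$⟩ʳ i))  ≈⟨ ≡[mod]-sym (t (conj ξ μ) (σ′ ⟨$⟩ʳ i)) _ (t-conj≡[mod] μ (σ′ ⟨$⟩ʳ i)) ⟩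
      t (conj ξ μ) (σ′ ⟨$⟩ʳ i)       ∎
      where open ≈-Reasoning (≡[mod]-setoid n)

lemma3p4 : (n : ℕ) (ξ : Monomial n)
    -- ξΓξ⁻¹ is again a tiled order containing diag(Δ,…,Δ)
    → (∀ (μ : ExpMat n) → IsTiled μ → IsTiled (conj ξ μ))
    -- Γ ∼ Γ' implies ξΓξ⁻¹ ∼ ξΓ'ξ⁻¹
    × (∀ (μ μ′ : ExpMat n) → IsTiled μ → IsTiled μ′ → μ ∼ μ′ → conj ξ μ ∼ conj ξ μ′)
    -- action laws: identity acts trivially, (ξη)Γ(ξη)⁻¹ = ξ(ηΓη⁻¹)ξ⁻¹
    × (∀ (μ : ExpMat n) → ∀ i j → conj idₘ μ i j ≡ μ i j)
    × (∀ (η : Monomial n) (μ : ExpMat n) → ∀ i j → conj (ξ ·ₘ η) μ i j ≡ conj ξ (conj η μ) i j)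
    -- structural invariants and types of ξΓξ⁻¹
    × (∀ (μ : ExpMat n) → IsTiled μ →
         (∀ i j l → m (conj ξ μ) i j l ≡ m μ (τ ξ ⟨$⟩ʳ i) (τ ξ ⟨$⟩ʳ j) (τ ξ ⟨$⟩ʳ l))
         × (∀ i → t (conj ξ μ) i ≡[mod n ] (tMono ξ + t μ (τ ξ ⟨$⟩ʳ i))))
lemma3p4 n ξ =
    (λ _ → conj-isTiled ξ)
  , (λ μ μ′ _ _ → conj-resp-∼ ξ {μ} {μ′})
  , conj-idₘ
  , conj-·ₘ ξ
  , λ μ _ → m-conj ξ μ , t-conj≡[mod] ξ μ
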